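{- The set of finite factors of $\mathbf{t}_{3/2}$, and the set of finite factors of $\mathbf{t}'$, are each closed under reversal: if a word $u\in\{0,1\}^*$ is a factor of one of these words, then so is its reversal $u^R$.
   Context: Let $\mathbf{t}_{3/2}=(t_n)_{n\ge0}\in\{0,1\}^{\mathbb{N}}$ be the unique binary sequence with $t_0=0$ such that $t_{3n}=t_{3n+1}=t_{2n}$ and $t_{3n+2}=1-t_{2n+1}$ for all $n\ge0$. Let $\mathbf{t}'$ be the unique binary sequence starting with $0$ that is a fixed point of the $2$-block substitution $00\mapsto 010,\ 01\mapsto 010,\ 10\mapsto 101,\ 11\mapsto 101$ (applied to consecutive non-overlapping length-$2$ blocks). The reversal of $a_0a_1\cdots a_{\ell-1}$ is $a_{\ell-1}\cdots a_1a_0$. -}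

module Defs where

open import Data.Bool using (Bool; true; false; not)
open import Data.Nat using (ℕ; zero; suc; _+_; _*_)
open import Data.List using (List; []; _∷_; length)
open import Data.Product using (∃; _×_)
open import Relation.Binary.PropositionalEquality using (_≡_)

-- Binary letters: 0 is false, 1 is true.  Infinite words are functions ℕ → Bool.

window : (ℕ → Bool) → ℕ → ℕ → List Bool
window t i zero    = []
window t i (suc ℓ) = t i ∷ window t (suc i) ℓ

Factor : List Bool → (ℕ → Bool) → Set
Factor u t = ∃ λ i → window t i (length u) ≡ u

IsT32 : (ℕ → Bool) → Set
IsT32 t = (t 0 ≡ false)
        × (∀ n → t (3 * n) ≡ t (2 * n))
        × (∀ n → t (3 * n + 1) ≡ t (2 * n))
        × (∀ n → t (3 * n + 2) ≡ not (t (2 * n + 1)))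

-- The 2-block substitution 00 ↦ 010, 01 ↦ 010, 10 ↦ 101, 11 ↦ 101,
-- given as the three letters (positions 0,1,2) of the image of the block ab.
σ₀ σ₁ σ₂ : Bool → Bool → Bool
σ₀ false false = false
σ₀ false true  = false
σ₀ true  false = true
σ₀ true  true  = true
σ₁ false false = true
σ₁ false true  = true
σ₁ true  false = false
σ₁ true  true  = false
σ₂ false false = false
σ₂ false true  = false
σ₂ true  false = true
σ₂ true  true  = true

-- t is a fixed point of the substitution applied to consecutive
-- non-overlapping length-2 blocks, and starts with 0: the image of the
-- block t_{2n} t_{2n+1} occupies positions 3n, 3n+1, 3n+2.
IsT' : (ℕ → Bool) → Set
IsT' t = (t 0 ≡ false)
       × (∀ n → t (3 * n)     ≡ σ₀ (t (2 * n)) (t (2 * n + 1)))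
       × (∀ n → t (3 * n + 1) ≡ σ₁ (t (2 * n)) (t (2 * n + 1)))
       × (∀ n → t (3 * n + 2) ≡ σ₂ (t (2 * n)) (t (2 * n + 1)))

ClosedUnderReversal : (ℕ → Bool) → Set
ClosedUnderReversal t = ∀ u → Factor u t → Factor (Data.List.reverse u) t

-- Say t is mirrored about c up to e when t (c − i) = t i for all i ≤ e ≤ c. If t has such
-- mirrors for every e, every factor lies in a prefix t[0 .. e], so its reversal occurs in
-- t[c − e .. c].
--
-- Let μ be the morphism 0 ↦ 010, 1 ↦ 101. A mirror of u about c gives one of μ(u) about
-- 3c + 2, three times as long. Now t' = μ(s) for s(n) = t'(2n), and s satisfies the
-- recurrences of t₃/₂; conversely t₃/₂(n) = μ(t₃/₂)(2n), so a mirror of t₃/₂ about 2c up to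
-- e passes to μ(t₃/₂) and back, giving one about 3c + 1 up to e + 1. After k such steps,
-- the one-letter mirror at any c with t₃/₂(c) = 0 and c ≡ −2 (mod 2ᵏ) reaches length k.
--
-- Such c exist because t₃/₂(D·3ⁿ + x) = t₃/₂(x) xor t₃/₂(D·2ⁿ) for x ≤ n, and 3ⁿ is
-- invertible modulo 2ᵏ: choosing D·3ⁿ ≡ −2 and x ≡ 0 (mod 2ᵏ) with t₃/₂(x) = 1, one of
-- D·3ⁿ and D·3ⁿ + x carries a 0. Such x is found in the same way from t₃/₂(2) = 1.

module Submission where

open import Defs
open import Data.Bool using (Bool; true; false; not; _xor_)
open import Data.Bool.Properties using (xor-assoc)
open import Data.Nat using (ℕ; zero; suc; _+_; _*_; _∸_; _^_; _≤_; z≤n; s≤s)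
open import Data.Nat.Properties
open import Algebra.Properties.CommutativeSemigroup *-commutativeSemigroup using (xy∙z≈xz∙y)
open import Data.Nat.Tactic.RingSolver using (solve-∀)
open import Data.List using ([]; _∷_; _++_; length; reverse)
open import Data.List.Properties using (reverse-++; length-reverse)
open import Data.Product using (_×_; _,_; ∃; ∃₂; proj₁; proj₂)
open import Data.Sum using (_⊎_; inj₁; inj₂)
open import Function using (_∘_)
open import Relation.Binary.PropositionalEquality
open ≡-Reasoning

Mirrored : (ℕ → Bool) → ℕ → ℕ → Set
Mirrored t c e = ∀ i j → i + j ≡ c → i ≤ e → t j ≡ t i

LongMirrors : (ℕ → Bool) → Set
LongMirrors t = ∀ e → ∃ λ c → e ≤ c × Mirrored t c e

Mirrored-mono : ∀ {t c e e′} → e′ ≤ e → Mirrored t c e → Mirrored t c e′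
Mirrored-mono e′≤e M i j i+j≡c i≤e′ = M i j i+j≡c (≤-trans i≤e′ e′≤e)

Mirrored-≗ : ∀ {s t c e} → s ≗ t → Mirrored s c e → Mirrored t c e
Mirrored-≗ s≗t M i j i+j≡c i≤e = trans (sym (s≗t j)) (trans (M i j i+j≡c i≤e) (s≗t i))

window-snoc : ∀ t p L → window t p (suc L) ≡ window t p L ++ t (p + L) ∷ []
window-snoc t p zero    = cong (λ k → t k ∷ []) (sym (+-identityʳ p))
window-snoc t p (suc L) = cong (t p ∷_) (begin
  window t (suc p) (suc L)
    ≡⟨ window-snoc t (suc p) L ⟩
  window t (suc p) L ++ t (suc p + L) ∷ []
    ≡⟨ cong (λ k → window t (suc p) L ++ t k ∷ []) (sym (+-suc p L)) ⟩
  window t (suc p) L ++ t (p + suc L) ∷ []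
    ∎)

window-mirrored : ∀ {t c e} → Mirrored t c e → ∀ L p q → p + L ≤ suc e → q + (p + L) ≡ suc c →
                  window t q L ≡ reverse (window t p L)
window-mirrored M zero    p q _     _   = refl
window-mirrored {t} {c} {e} M (suc L) p q bound sum = begin
  t q ∷ window t (suc q) L
    ≡⟨ cong₂ _∷_ head (window-mirrored M L p (suc q) bound′ sum′) ⟩
  t (p + L) ∷ reverse (window t p L)
    ≡⟨ sym (reverse-++ (window t p L) (t (p + L) ∷ [])) ⟩
  reverse (window t p L ++ t (p + L) ∷ [])
    ≡⟨ cong reverse (sym (window-snoc t p L)) ⟩
  reverse (window t p (suc L))
    ∎
  where
  p+L<1+e : suc (p + L) ≤ suc e
  p+L<1+e = subst (_≤ suc e) (+-suc p L) bound
  bound′ : p + L ≤ suc e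
  bound′ = ≤-trans (n≤1+n _) p+L<1+e
  sum′ : suc q + (p + L) ≡ suc c
  sum′ = trans (sym (+-suc q (p + L))) (trans (cong (q +_) (sym (+-suc p L))) sum)
  head : t q ≡ t (p + L)
  head = M (p + L) q (suc-injective (trans (cong suc (+-comm (p + L) q)) sum′)) (≤-pred p+L<1+e)

closedUnderReversal : ∀ {t} → LongMirrors t → ClosedUnderReversal t
closedUnderReversal {t} mirrors u (p , window≡u) =
  let c , p+L≤c , M = mirrors (p + length u)
      q = suc c ∸ (p + length u)
  in  q , (begin
    window t q (length (reverse u)) ≡⟨ cong (window t q) (length-reverse u) ⟩
    window t q (length u)
      ≡⟨ window-mirrored M (length u) p q (n≤1+n _) (m∸n+n≡m (m≤n⇒m≤1+n p+L≤c)) ⟩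
    reverse (window t p (length u)) ≡⟨ cong reverse window≡u ⟩
    reverse u                       ∎)

data Digits3 : ℕ → Set where
  _*3+0 : ∀ q → Digits3 (q * 3 + 0)
  _*3+1 : ∀ q → Digits3 (q * 3 + 1)
  _*3+2 : ∀ q → Digits3 (q * 3 + 2)

digits3 : ∀ x → Digits3 x
digits3 0 = 0 *3+0
digits3 1 = 0 *3+1
digits3 2 = 0 *3+2
digits3 (suc (suc (suc x))) with digits3 x
... | q *3+0 = suc q *3+0
... | q *3+1 = suc q *3+1
... | q *3+2 = suc q *3+2

*3+-≤-cancel : ∀ q e {a} → q * 3 + a ≤ e * 3 + 2 → q ≤ e
*3+-≤-cancel zero    e       _                         = z≤n
*3+-≤-cancel (suc q) zero    (s≤s (s≤s ()))
*3+-≤-cancel (suc q) (suc e) (s≤s (s≤s (s≤s q≤e)))     = s≤s (*3+-≤-cancel q e q≤e)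

*3+-cancel : ∀ q c {j b} → q * 3 + j ≡ c * 3 + b → b ≤ 2 → ∃ λ p → j ≡ p * 3 + b × q + p ≡ c
*3+-cancel zero    c       eq   _ = c , eq , refl
*3+-cancel (suc q) zero    refl (s≤s (s≤s ()))
*3+-cancel (suc q) (suc c) eq   b≤2 with *3+-cancel q c (suc-injective (suc-injective (suc-injective eq))) b≤2
... | p , j≡ , q+p≡c = p , j≡ , cong suc q+p≡c

*3+-complement : ∀ q c {a b j} → q * 3 + a + j ≡ c * 3 + (a + b) → b ≤ 2 →
                 ∃ λ p → j ≡ p * 3 + b × q + p ≡ c
*3+-complement q c {a} {b} {j} eq = *3+-cancel q c (+-cancelˡ-≡ a _ _ (begin
  a + (q * 3 + j)  ≡⟨ shuffle (q * 3) a j ⟩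
  q * 3 + a + j    ≡⟨ eq ⟩
  c * 3 + (a + b)  ≡⟨ sym (shuffle′ (c * 3) a b) ⟩
  a + (c * 3 + b)  ∎))
  where
  shuffle : ∀ x a j → a + (x + j) ≡ x + a + j
  shuffle = solve-∀
  shuffle′ : ∀ y a b → a + (y + b) ≡ y + (a + b)
  shuffle′ = solve-∀

μ : (ℕ → Bool) → ℕ → Bool
μ u 0 = u 0
μ u 1 = not (u 0)
μ u 2 = u 0
μ u (suc (suc (suc x))) = μ (u ∘ suc) x

μ-3q : ∀ u q → μ u (q * 3 + 0) ≡ u q
μ-3q u zero    = refl
μ-3q u (suc q) = μ-3q (u ∘ suc) q

μ-3q+1 : ∀ u q → μ u (q * 3 + 1) ≡ not (u q)
μ-3q+1 u zero    = refl
μ-3q+1 u (suc q) = μ-3q+1 (u ∘ suc) q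

μ-3q+2 : ∀ u q → μ u (q * 3 + 2) ≡ u q
μ-3q+2 u zero    = refl
μ-3q+2 u (suc q) = μ-3q+2 (u ∘ suc) q

μ-double-3q : ∀ u q → μ u ((q * 3 + 0) * 2) ≡ u (q * 2)
μ-double-3q u q = trans (cong (μ u) (double q)) (μ-3q u (q * 2))
  where
  double : ∀ q → (q * 3 + 0) * 2 ≡ q * 2 * 3 + 0
  double = solve-∀

μ-double-3q+1 : ∀ u q → μ u ((q * 3 + 1) * 2) ≡ u (q * 2)
μ-double-3q+1 u q = trans (cong (μ u) (double q)) (μ-3q+2 u (q * 2))
  where
  double : ∀ q → (q * 3 + 1) * 2 ≡ q * 2 * 3 + 2
  double = solve-∀

μ-double-3q+2 : ∀ u q → μ u ((q * 3 + 2) * 2) ≡ not (u (q * 2 + 1))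
μ-double-3q+2 u q = trans (cong (μ u) (double q)) (μ-3q+1 u (q * 2 + 1))
  where
  double : ∀ q → (q * 3 + 2) * 2 ≡ (q * 2 + 1) * 3 + 1
  double = solve-∀

Mirrored-μ : ∀ {u c e} → Mirrored u c e → Mirrored (μ u) (c * 3 + 2) (e * 3 + 2)
Mirrored-μ {u} {c} {e} M i j i+j≡ i≤ with digits3 i
... | q *3+0 with *3+-complement q c i+j≡ ≤-refl
...   | p , refl , q+p≡c =
  trans (μ-3q+2 u p) (trans (M q p q+p≡c (*3+-≤-cancel q e i≤)) (sym (μ-3q u q)))
Mirrored-μ {u} {c} {e} M i j i+j≡ i≤ | q *3+1 with *3+-complement q c i+j≡ (n≤1+n 1)
...   | p , refl , q+p≡c =
  trans (μ-3q+1 u p) (trans (cong not (M q p q+p≡c (*3+-≤-cancel q e i≤))) (sym (μ-3q+1 u q)))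
Mirrored-μ {u} {c} {e} M i j i+j≡ i≤ | q *3+2 with *3+-complement q c i+j≡ z≤n
...   | p , refl , q+p≡c =
  trans (μ-3q u p) (trans (M q p q+p≡c (*3+-≤-cancel q e i≤)) (sym (μ-3q+2 u q)))

Mirrored-half : ∀ {u s c e E} → u ≗ s ∘ (_* 2) → e * 2 ≤ E → Mirrored s (c * 2) E → Mirrored u c e
Mirrored-half {u} {s} {c} u≡s e*2≤E M i j i+j≡c i≤e = begin
  u j       ≡⟨ u≡s j ⟩
  s (j * 2) ≡⟨ M (i * 2) (j * 2) i*2+j*2≡c*2 (≤-trans (*-monoˡ-≤ 2 i≤e) e*2≤E) ⟩
  s (i * 2) ≡⟨ sym (u≡s i) ⟩
  u i       ∎
  where
  i*2+j*2≡c*2 : i * 2 + j * 2 ≡ c * 2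
  i*2+j*2≡c*2 = trans (sym (*-distribʳ-+ 2 i j)) (cong (_* 2) i+j≡c)

twoThirds : ℕ → ℕ
twoThirds 0 = 0
twoThirds 1 = 0
twoThirds 2 = 1
twoThirds (suc (suc (suc x))) = suc (suc (twoThirds x))

is2mod3 : ℕ → Bool
is2mod3 0 = false
is2mod3 1 = false
is2mod3 2 = true
is2mod3 (suc (suc (suc x))) = is2mod3 x

twoThirds-shift : ∀ y x → twoThirds (y * 3 + x) ≡ y * 2 + twoThirds x
twoThirds-shift zero    x = refl
twoThirds-shift (suc y) x = cong (suc ∘ suc) (twoThirds-shift y x)

is2mod3-shift : ∀ y x → is2mod3 (y * 3 + x) ≡ is2mod3 x
is2mod3-shift zero    x = refl
is2mod3-shift (suc y) x = is2mod3-shift y x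

twoThirds-suc≤ : ∀ x → twoThirds (suc x) ≤ x
twoThirds-suc≤ 0 = z≤n
twoThirds-suc≤ 1 = s≤s z≤n
twoThirds-suc≤ 2 = s≤s (s≤s z≤n)
twoThirds-suc≤ (suc (suc (suc x))) = s≤s (s≤s (m≤n⇒m≤1+n (twoThirds-suc≤ x)))

twoThirds-≤ : ∀ {x n} → x ≤ suc n → twoThirds x ≤ n
twoThirds-≤ {zero}  _          = z≤n
twoThirds-≤ {suc x} (s≤s x≤n) = ≤-trans (twoThirds-suc≤ x) x≤n

halve : ∀ c {y} → 2 + c ≡ y * 2 → ∃ λ c₀ → c ≡ c₀ * 2 × suc c₀ ≡ y
halve c {suc y} eq = y , suc-injective (suc-injective eq) , refl

data Parity : ℕ → Set where
  even : ∀ h → Parity (h * 2)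
  odd  : ∀ h → Parity (1 + h * 2)

parity : ∀ n → Parity n
parity zero = even 0
parity (suc n) with parity n
... | even h = odd h
... | odd h  = even (suc h)

-- Correct the parity of the cofactor by adding 2^k to D when it is odd.
odd-invertible-mod-2^ : ∀ {b} g → b ≡ 1 + g * 2 → ∀ k a → ∃₂ λ D m → D * b + a ≡ m * 2 ^ k
odd-invertible-mod-2^ g b-odd zero a = 0 , a , sym (*-identityʳ a)
odd-invertible-mod-2^ {b} g b-odd (suc k) a with odd-invertible-mod-2^ g b-odd k a
... | D , m , eq with parity m
...   | even h = D , h , trans eq (*-assoc h 2 (2 ^ k))
...   | odd h  = D + 2 ^ k , suc (h + g) , (begin
  (D + 2 ^ k) * b + a                       ≡⟨ split D (2 ^ k) b a ⟩
  D * b + a + 2 ^ k * b                     ≡⟨ cong₂ (λ x y → x + 2 ^ k * y) eq b-odd ⟩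
  (1 + h * 2) * 2 ^ k + 2 ^ k * (1 + g * 2) ≡⟨ merge (2 ^ k) h g ⟩
  suc (h + g) * (2 * 2 ^ k)                 ∎)
  where
  split : ∀ D P b a → (D + P) * b + a ≡ D * b + a + P * b
  split = solve-∀
  merge : ∀ P h g → (1 + h * 2) * P + P * (1 + g * 2) ≡ suc (h + g) * (2 * P)
  merge = solve-∀

3^-odd : ∀ n → ∃ λ g → 3 ^ n ≡ 1 + g * 2
3^-odd zero = 0 , refl
3^-odd (suc n) with 3^-odd n
... | g , eq = 1 + 3 * g , trans (cong (3 *_) eq) (triple g)
  where
  triple : ∀ g → 3 * (1 + g * 2) ≡ 1 + (1 + 3 * g) * 2
  triple = solve-∀

-- Opaque, since `with` on an unfolded call normalises the ring-solver proofs inside.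
opaque
  3^-invertible-mod-2^ : ∀ n k a → ∃₂ λ D m → D * 3 ^ n + a ≡ m * 2 ^ k
  3^-invertible-mod-2^ n = odd-invertible-mod-2^ (proj₁ (3^-odd n)) (proj₂ (3^-odd n))

module _ {t : ℕ → Bool} (isT32 : IsT32 t) where

  private
    t0 : t 0 ≡ false
    t0 = proj₁ isT32

    t-3q : ∀ q → t (q * 3 + 0) ≡ t (q * 2 + 0)
    t-3q q = begin
      t (q * 3 + 0) ≡⟨ cong t (trans (+-identityʳ _) (*-comm q 3)) ⟩
      t (3 * q)     ≡⟨ proj₁ (proj₂ isT32) q ⟩
      t (2 * q)     ≡⟨ cong t (trans (*-comm 2 q) (sym (+-identityʳ _))) ⟩
      t (q * 2 + 0) ∎

    t-3q+1 : ∀ q → t (q * 3 + 1) ≡ t (q * 2 + 0)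
    t-3q+1 q = begin
      t (q * 3 + 1) ≡⟨ cong (λ x → t (x + 1)) (*-comm q 3) ⟩
      t (3 * q + 1) ≡⟨ proj₁ (proj₂ (proj₂ isT32)) q ⟩
      t (2 * q)     ≡⟨ cong t (trans (*-comm 2 q) (sym (+-identityʳ _))) ⟩
      t (q * 2 + 0) ∎

    t-3q+2 : ∀ q → t (q * 3 + 2) ≡ not (t (q * 2 + 1))
    t-3q+2 q = begin
      t (q * 3 + 2)           ≡⟨ cong (λ x → t (x + 2)) (*-comm q 3) ⟩
      t (3 * q + 2)           ≡⟨ proj₂ (proj₂ (proj₂ isT32)) q ⟩
      not (t (2 * q + 1))     ≡⟨ cong (λ x → not (t (x + 1))) (*-comm 2 q) ⟩
      not (t (q * 2 + 1))     ∎

    digits-shift : ∀ y x → is2mod3 (y * 3 + x) xor t (twoThirds (y * 3 + x))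
                         ≡ is2mod3 x xor t (y * 2 + twoThirds x)
    digits-shift y x = cong₂ _xor_ (is2mod3-shift y x) (cong t (twoThirds-shift y x))

  t-unfold : ∀ x → t x ≡ is2mod3 x xor t (twoThirds x)
  t-unfold x with digits3 x
  ... | q *3+0 = trans (t-3q q)   (sym (digits-shift q 0))
  ... | q *3+1 = trans (t-3q+1 q) (sym (digits-shift q 1))
  ... | q *3+2 = trans (t-3q+2 q) (sym (digits-shift q 2))

  t-shift : ∀ y x → t (y * 3 + x) ≡ is2mod3 x xor t (y * 2 + twoThirds x)
  t-shift y x = trans (t-unfold (y * 3 + x)) (digits-shift y x)

  -- The first n digits of D·3ⁿ + x in base 3/2 are those of x, after which D·2ⁿ remains.
  t-transfer : ∀ n x D → x ≤ n → t (D * 3 ^ n + x) ≡ t x xor t (D * 2 ^ n)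
  t-transfer zero .0 D z≤n = trans (cong t (+-identityʳ (D * 1))) (cong (_xor t (D * 1)) (sym t0))
  t-transfer (suc n) x D x≤1+n = begin
    t (D * 3 ^ suc n + x)
      ≡⟨ cong (λ y → t (y + x)) (pull-3 D (3 ^ n)) ⟩
    t (D * 3 ^ n * 3 + x)
      ≡⟨ t-shift (D * 3 ^ n) x ⟩
    is2mod3 x xor t (D * 3 ^ n * 2 + twoThirds x)
      ≡⟨ cong (λ y → is2mod3 x xor t (y + twoThirds x)) (xy∙z≈xz∙y D (3 ^ n) 2) ⟩
    is2mod3 x xor t (D * 2 * 3 ^ n + twoThirds x)
      ≡⟨ cong (is2mod3 x xor_) (t-transfer n (twoThirds x) (D * 2) (twoThirds-≤ x≤1+n)) ⟩
    is2mod3 x xor (t (twoThirds x) xor t (D * 2 * 2 ^ n))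
      ≡⟨ sym (xor-assoc (is2mod3 x) _ _) ⟩
    (is2mod3 x xor t (twoThirds x)) xor t (D * 2 * 2 ^ n)
      ≡⟨ cong₂ _xor_ (sym (t-unfold x)) (cong t (*-assoc D 2 (2 ^ n))) ⟩
    t x xor t (D * 2 ^ suc n)
      ∎
    where
    pull-3 : ∀ D P → D * (3 * P) ≡ D * P * 3
    pull-3 = solve-∀

  t2 : t 2 ≡ true
  t2 = trans (t-unfold 2) (cong not (trans (t-unfold 1) t0))

  true-among : ∀ n D → 2 ≤ n → t (D * 2 ^ n) ≡ true ⊎ t (D * 3 ^ n + 2) ≡ true
  true-among n D 2≤n with t (D * 2 ^ n) in tD
  ... | true  = inj₁ refl
  ... | false = inj₂ (trans (t-transfer n 2 D 2≤n) (cong₂ _xor_ t2 tD))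

  false-among : ∀ n x D → t x ≡ true → x ≤ n → t (D * 3 ^ n) ≡ false ⊎ t (D * 3 ^ n + x) ≡ false
  false-among n x D tx x≤n with t (D * 2 ^ n) in tD
  ... | false = inj₁ (trans (cong t (sym (+-identityʳ _))) (trans (t-transfer n 0 D z≤n) (cong₂ _xor_ t0 tD)))
  ... | true  = inj₂ (trans (t-transfer n x D x≤n) (cong₂ _xor_ tx tD))

  true-at-multiple-of-2^ : ∀ k → ∃ λ q → t (q * 2 ^ k) ≡ true
  true-at-multiple-of-2^ k with 3^-invertible-mod-2^ (2 + k) k 2
  ... | D , m , D*3ⁿ+2≡ with true-among (2 + k) D (m≤m+n 2 k)
  ...   | inj₂ tD*3ⁿ+2 = m , trans (cong t (sym D*3ⁿ+2≡)) tD*3ⁿ+2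
  ...   | inj₁ tD*2ⁿ   = D * 4 , trans (cong t (regroup D (2 ^ k))) tD*2ⁿ
    where
    regroup : ∀ D P → D * 4 * P ≡ D * (2 * (2 * P))
    regroup = solve-∀

  false-at-−2-mod-2^ : ∀ k → ∃₂ λ c d → 2 + c ≡ d * 2 ^ k × t c ≡ false
  false-at-−2-mod-2^ k with true-at-multiple-of-2^ k
  ... | q , tx with 3^-invertible-mod-2^ (q * 2 ^ k) k 2
  ...   | D , m , D*3ˣ+2≡ with false-among (q * 2 ^ k) (q * 2 ^ k) D tx ≤-refl
  ...     | inj₁ tD*3ˣ   = D * 3 ^ (q * 2 ^ k) , m , trans (+-comm 2 _) D*3ˣ+2≡ , tD*3ˣ
  ...     | inj₂ tD*3ˣ+x = D * 3 ^ x + x , m + q , 2+c≡ , tD*3ˣ+x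
    where
    x : ℕ
    x = q * 2 ^ k
    regroup : ∀ X Y → 2 + (X + Y) ≡ X + 2 + Y
    regroup = solve-∀
    2+c≡ : 2 + (D * 3 ^ x + x) ≡ (m + q) * 2 ^ k
    2+c≡ = begin
      2 + (D * 3 ^ x + x)    ≡⟨ regroup (D * 3 ^ x) x ⟩
      D * 3 ^ x + 2 + x      ≡⟨ cong (_+ x) D*3ˣ+2≡ ⟩
      m * 2 ^ k + q * 2 ^ k  ≡⟨ sym (*-distribʳ-+ (2 ^ k) m q) ⟩
      (m + q) * 2 ^ k        ∎

  t-double : t ≗ μ t ∘ (_* 2)
  t-double n with digits3 n
  ... | q *3+0 = trans (t-3q q)   (trans (cong t (+-identityʳ _)) (sym (μ-double-3q t q)))
  ... | q *3+1 = trans (t-3q+1 q) (trans (cong t (+-identityʳ _)) (sym (μ-double-3q+1 t q)))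
  ... | q *3+2 = trans (t-3q+2 q) (sym (μ-double-3q+2 t q))

  Mirrored-letter : ∀ {c} → t c ≡ false → Mirrored t c 0
  Mirrored-letter tc .0 j j≡c z≤n = trans (cong t j≡c) (trans tc (sym t0))

  Mirrored-3/2 : ∀ {c e} → Mirrored t (c * 2) e → Mirrored t (c * 3 + 1) (suc e)
  Mirrored-3/2 {c} {e} M =
    Mirrored-half t-double 2+2e≤3e+2 (subst (λ C → Mirrored (μ t) C (e * 3 + 2)) (centre c) (Mirrored-μ M))
    where
    centre : ∀ c → c * 2 * 3 + 2 ≡ (c * 3 + 1) * 2
    centre = solve-∀
    2+2e≤3e+2 : suc e * 2 ≤ e * 3 + 2
    2+2e≤3e+2 = ≤-trans (+-monoʳ-≤ 2 (*-monoʳ-≤ e (n≤1+n 2))) (≤-reflexive (+-comm 2 (e * 3)))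

  mirror-chain : ∀ k d c → 2 + c ≡ d * 2 ^ k → t c ≡ false →
                 ∃ λ c′ → 2 + c′ ≡ d * 3 ^ k × k ≤ c′ × Mirrored t c′ k
  mirror-chain zero    d c 2+c≡ tc = c , 2+c≡ , z≤n , Mirrored-letter tc
  mirror-chain (suc k) d c 2+c≡ tc with mirror-chain k (d * 2) c (trans 2+c≡ (sym (*-assoc d 2 (2 ^ k)))) tc
  ... | c′ , 2+c′≡ , k≤c′ , M with halve c′ {d * 3 ^ k} (trans 2+c′≡ (xy∙z≈xz∙y d 2 (3 ^ k)))
  ...   | c₀ , refl , 1+c₀≡ = c₀ * 3 + 1 , 2+c≡′ , bound , Mirrored-3/2 {c₀} M
    where
    triple : ∀ c₀ → 2 + (c₀ * 3 + 1) ≡ suc c₀ * 3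
    triple = solve-∀
    pull-3 : ∀ d P → d * P * 3 ≡ d * (3 * P)
    pull-3 = solve-∀
    2+c≡′ : 2 + (c₀ * 3 + 1) ≡ d * 3 ^ suc k
    2+c≡′ = trans (triple c₀) (trans (cong (_* 3) 1+c₀≡) (pull-3 d (3 ^ k)))
    bound : suc k ≤ c₀ * 3 + 1
    bound = ≤-trans (s≤s (≤-trans k≤c′ (*-monoʳ-≤ c₀ (n≤1+n 2)))) (≤-reflexive (+-comm 1 (c₀ * 3)))

  long-mirrors : LongMirrors t
  long-mirrors e =
    let c , d , 2+c≡ , tc = false-at-−2-mod-2^ e
        c′ , _ , e≤c′ , M = mirror-chain e d c 2+c≡ tc
    in  c′ , e≤c′ , M

σ-image : ∀ a b → σ₀ a b ≡ a × σ₁ a b ≡ not a × σ₂ a b ≡ a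
σ-image false false = refl , refl , refl
σ-image false true  = refl , refl , refl
σ-image true  false = refl , refl , refl
σ-image true  true  = refl , refl , refl

module _ {t : ℕ → Bool} (isT' : IsT' t) where

  evens : ℕ → Bool
  evens n = t (2 * n)

  private
    t-3q : ∀ q → t (3 * q) ≡ evens q
    t-3q q = trans (proj₁ (proj₂ isT') q) (proj₁ (σ-image _ _))

    t-3q+1 : ∀ q → t (3 * q + 1) ≡ not (evens q)
    t-3q+1 q = trans (proj₁ (proj₂ (proj₂ isT')) q) (proj₁ (proj₂ (σ-image _ _)))

    t-3q+2 : ∀ q → t (3 * q + 2) ≡ evens q
    t-3q+2 q = trans (proj₂ (proj₂ (proj₂ isT')) q) (proj₂ (proj₂ (σ-image _ _)))

  t≗μ-evens : t ≗ μ evens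
  t≗μ-evens x with digits3 x
  ... | q *3+0 = trans (cong t (trans (+-identityʳ _) (*-comm q 3)))   (trans (t-3q q)   (sym (μ-3q evens q)))
  ... | q *3+1 = trans (cong (λ y → t (y + 1)) (*-comm q 3)) (trans (t-3q+1 q) (sym (μ-3q+1 evens q)))
  ... | q *3+2 = trans (cong (λ y → t (y + 2)) (*-comm q 3)) (trans (t-3q+2 q) (sym (μ-3q+2 evens q)))

  evens-isT32 : IsT32 evens
  evens-isT32 = proj₁ isT'
              , (λ n → trans (cong t (double-3n n))   (t-3q (2 * n)))
              , (λ n → trans (cong t (double-3n+1 n)) (t-3q+2 (2 * n)))
              , (λ n → trans (cong t (double-3n+2 n)) (t-3q+1 (2 * n + 1)))
    where
    double-3n : ∀ n → 2 * (3 * n) ≡ 3 * (2 * n)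
    double-3n = solve-∀
    double-3n+1 : ∀ n → 2 * (3 * n + 1) ≡ 3 * (2 * n) + 2
    double-3n+1 = solve-∀
    double-3n+2 : ∀ n → 2 * (3 * n + 2) ≡ 3 * (2 * n + 1) + 1
    double-3n+2 = solve-∀

  t′-long-mirrors : LongMirrors t
  t′-long-mirrors e =
    let c , e≤c , M = long-mirrors evens-isT32 e
    in  c * 3 + 2 , ≤-trans e≤c (e≤e*3+2 c)
      , Mirrored-mono (e≤e*3+2 e) (Mirrored-≗ (sym ∘ t≗μ-evens) (Mirrored-μ M))
    where
    e≤e*3+2 : ∀ e → e ≤ e * 3 + 2
    e≤e*3+2 e = ≤-trans (m≤m*n e 3) (m≤m+n (e * 3) 2)

proposition17 : ((t : ℕ → Bool) → IsT32 t → ClosedUnderReversal t)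
    × ((t : ℕ → Bool) → IsT' t → ClosedUnderReversal t)
proposition17 = (λ t isT32 → closedUnderReversal (long-mirrors isT32))
              , (λ t isT' → closedUnderReversal (t′-long-mirrors isT'))
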